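{- Let $G$ be a graph with vertex set $\mathcal{V}$, $|\mathcal{V}|=n$, having at least one edge. Then $$\operatorname{mod}(G)\le 4\max_{S\subseteq\mathcal{V},\,|S|\ge n/2}\left(\frac{e(S)}{e(G)}-\left(\frac{\operatorname{vol}(S)}{\operatorname{vol}(G)}\right)^2\right).$$
   Context: For a graph $G$, $e(G)$ is its number of edges, $e(S)$ is the number of edges with both ends in $S\subseteq V(G)$, $\operatorname{vol}(S)$ is the sum of degrees of the vertices of $S$, and $\operatorname{vol}(G)=\operatorname{vol}(V(G))$. For a partition $\mathcal{A}$ of $V(G)$, $\operatorname{mod}_{\mathcal{A}}(G)=\sum_{S\in\mathcal{A}}\left(\frac{e(S)}{e(G)}-\left(\frac{\operatorname{vol}(S)}{\operatorname{vol}(G)}\right)^2\right)$, and $\operatorname{mod}(G)=\max_{\mathcal{A}}\operatorname{mod}_{\mathcal{A}}(G)$ over all partitions of $V(G)$. -}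

module Defs where

open import Data.Nat as ℕ using (ℕ; zero; suc; _<ᵇ_)
open import Data.Fin using (Fin; zero; suc; toℕ; _≟_)
open import Data.Bool using (Bool; true; false; _∧_; if_then_else_; T)
open import Data.Integer using (+_)
open import Data.Rational as ℚ using (ℚ; 0ℚ; _/_; _-_; _+_; _*_)
open import Relation.Binary.PropositionalEquality using (_≡_)
open import Relation.Nullary using (¬_)
open import Relation.Nullary.Decidable using (⌊_⌋)

record Graph (n : ℕ) : Set where
  field
    adj       : Fin n → Fin n → Bool
    adj-sym   : ∀ i j → adj i j ≡ adj j i
    adj-irref : ∀ i → adj i i ≡ false
open Graph public

VSet : ℕ → Set
VSet n = Fin n → Bool

sumFin : (n : ℕ) → (Fin n → ℕ) → ℕ
sumFin zero    f = 0
sumFin (suc n) f = f zero ℕ.+ sumFin n (λ i → f (suc i))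

sumFinℚ : (n : ℕ) → (Fin n → ℚ) → ℚ
sumFinℚ zero    f = 0ℚ
sumFinℚ (suc n) f = f zero + sumFinℚ n (λ i → f (suc i))

b2n : Bool → ℕ
b2n true  = 1
b2n false = 0

card : ∀ {n} → VSet n → ℕ
card {n} S = sumFin n (λ i → b2n (S i))

eS : ∀ {n} → Graph n → VSet n → ℕ
eS {n} G S = sumFin n (λ i → sumFin n (λ j →
  b2n ((toℕ i <ᵇ toℕ j) ∧ adj G i j ∧ S i ∧ S j)))

deg : ∀ {n} → Graph n → Fin n → ℕ
deg {n} G i = sumFin n (λ j → b2n (adj G i j))

vol : ∀ {n} → Graph n → VSet n → ℕ
vol {n} G S = sumFin n (λ i → b2n (S i) ℕ.* deg G i)

full : ∀ {n} → VSet n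
full _ = true

eG : ∀ {n} → Graph n → ℕ
eG G = eS G full

volG : ∀ {n} → Graph n → ℕ
volG G = vol G full

-- a / d as a rational; convention a / 0 = 0 (never used when e(G) ≥ 1)
ratio : ℕ → ℕ → ℚ
ratio a zero    = 0ℚ
ratio a (suc d) = (+ a) / suc d

q : ∀ {n} → Graph n → VSet n → ℚ
q G S = ratio (eS G S) (eG G) - (ratio (vol G S) (volG G) * ratio (vol G S) (volG G))

-- A partition of V into at most n (possibly empty) classes is given by a
-- labelling c : Fin n → Fin n; class k is {v | c v = k}. Empty classes
-- contribute 0 to the modularity sum.
Partition : ℕ → Set
Partition n = Fin n → Fin n

part : ∀ {n} → Partition n → Fin n → VSet n
part c k v = ⌊ c v ≟ k ⌋

modP : ∀ {n} → Graph n → Partition n → ℚ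
modP {n} G c = sumFinℚ n (λ k → q G (part c k))

-- With χ_S the indicator vector of S, q(S) = Q(χ_S) for the quadratic form
-- Q(x) = β(x, x) of the modularity matrix B = A / vol(G) − d dᵀ / vol(G)²
-- (A the adjacency matrix, d the degree vector), so mod_𝒜(G) = Σ_k Q(χ_{A_k}).
-- Choosing signs ε_k one class at a time so that each new cross term
-- 2 ε_k β(χ_{A_k}, Σ_{l>k} ε_l χ_{A_l}) is nonnegative gives Σ_k Q(χ_{A_k}) ≤ Q(s)
-- for the ±1-vector s = Σ_k ε_k χ_{A_k}. Since B annihilates the all-ones
-- vector 1, Q(s) = Q(2 χ_S − 1) = 4 q(S) for S = {s = 1}, and likewise
-- q(V ∖ S) = Q(1 − χ_S) = q(S); one of S and V ∖ S has at least n/2 vertices.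

module Submission where

open import Defs
open import Data.Nat using (ℕ; _≥_; _*_)
open import Data.Product using (Σ; _×_)
open import Data.Rational using (_≤_) renaming (_*_ to _*ℚ_)
open import Data.Rational using (1ℚ; _+_)

open import Algebra.Bundles using (CommutativeRing)
import Algebra.Properties.CommutativeMonoid.Sum as CommutativeMonoidSum
import Algebra.Properties.Semiring.Sum as SemiringSum
open import Data.Bool using (Bool; true; false; not; _∧_)
open import Data.Bool.Properties using (∧-comm; ∧-zeroʳ; ∧-identityʳ)
open import Data.Fin using (Fin; zero; suc; toℕ; _≟_)
import Data.Fin.Properties as Fin
open import Data.Integer as ℤ using (+_)
import Data.Integer.Properties as ℤP
open import Data.Nat as ℕ using (zero; suc; _<ᵇ_)
import Data.Nat.Properties as ℕP
open import Data.Product using (_,_; ∃-syntax; proj₁; proj₂)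
open import Data.Rational using (ℚ; 0ℚ; -_; _-_; _/_; toℚᵘ; fromℚᵘ) renaming (_*_ to _·_)
import Data.Rational.Properties as ℚP
open import Data.Rational.Solver using (module +-*-Solver)
import Data.Rational.Unnormalised as ℚᵘ
import Data.Rational.Unnormalised.Properties as ℚᵘP
open import Data.Sum using (_⊎_; inj₁; inj₂)
open import Data.Vec.Functional using (Vector; _∷_)
open import Function using (_∘_)
open import Relation.Binary.Definitions using (tri<; tri≈; tri>)
open import Relation.Binary.PropositionalEquality
open import Relation.Nullary using (¬_)
open import Relation.Nullary.Decidable using (⌊_⌋; dec-true; dec-false; ⌊⌋-map′)

open +-*-Solver using (solve; _:=_; _:+_; _:*_; _:-_)
module ℕΣ = CommutativeMonoidSum ℕP.+-0-commutativeMonoid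
open SemiringSum (CommutativeRing.semiring ℚP.+-*-commutativeRing)
  using (sum; sum-syntax; sum-cong-≗; ∑-distrib-+; ∑-comm; *-distribˡ-sum; sum-replicate-zero)

fromℕ : ℕ → ℚ
fromℕ a = + a / 1

fromℚᵘ-homo-+ : ∀ p q → fromℚᵘ (p ℚᵘ.+ q) ≡ fromℚᵘ p + fromℚᵘ q
fromℚᵘ-homo-+ p q = ℚP.toℚᵘ-injective (begin
  toℚᵘ (fromℚᵘ (p ℚᵘ.+ q))              ≈⟨ ℚP.toℚᵘ-fromℚᵘ (p ℚᵘ.+ q) ⟩
  p ℚᵘ.+ q                               ≈⟨ ℚᵘP.+-cong (ℚP.toℚᵘ-fromℚᵘ p) (ℚP.toℚᵘ-fromℚᵘ q) ⟨
  toℚᵘ (fromℚᵘ p) ℚᵘ.+ toℚᵘ (fromℚᵘ q)  ≈⟨ ℚP.toℚᵘ-homo-+ (fromℚᵘ p) (fromℚᵘ q) ⟨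
  toℚᵘ (fromℚᵘ p + fromℚᵘ q)            ∎)
  where open ℚᵘP.≃-Reasoning

fromℚᵘ-homo-* : ∀ p q → fromℚᵘ (p ℚᵘ.* q) ≡ fromℚᵘ p · fromℚᵘ q
fromℚᵘ-homo-* p q = ℚP.toℚᵘ-injective (begin
  toℚᵘ (fromℚᵘ (p ℚᵘ.* q))              ≈⟨ ℚP.toℚᵘ-fromℚᵘ (p ℚᵘ.* q) ⟩
  p ℚᵘ.* q                               ≈⟨ ℚᵘP.*-cong (ℚP.toℚᵘ-fromℚᵘ p) (ℚP.toℚᵘ-fromℚᵘ q) ⟨
  toℚᵘ (fromℚᵘ p) ℚᵘ.* toℚᵘ (fromℚᵘ q)  ≈⟨ ℚP.toℚᵘ-homo-* (fromℚᵘ p) (fromℚᵘ q) ⟨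
  toℚᵘ (fromℚᵘ p · fromℚᵘ q)            ∎)
  where open ℚᵘP.≃-Reasoning

-- (+ a) / suc d is by definition fromℚᵘ (mkℚᵘ (+ a) d), so the identities
-- below between such fractions come down to integer identities.

fromℕ-homo-+ : ∀ a b → fromℕ (a ℕ.+ b) ≡ fromℕ a + fromℕ b
fromℕ-homo-+ a b = begin
  fromℚᵘ (ℚᵘ.mkℚᵘ (+ (a ℕ.+ b)) 0)
    ≡⟨ cong numerator (ℤP.pos-+ a b) ⟩
  fromℚᵘ (ℚᵘ.mkℚᵘ (+ a ℤ.+ + b) 0)
    ≡⟨ cong₂ (λ u v → numerator (u ℤ.+ v)) (ℤP.*-identityʳ (+ a)) (ℤP.*-identityʳ (+ b)) ⟨
  fromℚᵘ (ℚᵘ.mkℚᵘ (+ a) 0 ℚᵘ.+ ℚᵘ.mkℚᵘ (+ b) 0)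
    ≡⟨ fromℚᵘ-homo-+ (ℚᵘ.mkℚᵘ (+ a) 0) (ℚᵘ.mkℚᵘ (+ b) 0) ⟩
  fromℕ a + fromℕ b
    ∎
  where
  open ≡-Reasoning
  numerator : ℤ.ℤ → ℚ
  numerator z = fromℚᵘ (ℚᵘ.mkℚᵘ z 0)

fromℕ-homo-* : ∀ a b → fromℕ (a * b) ≡ fromℕ a · fromℕ b
fromℕ-homo-* a b = trans (cong (λ z → fromℚᵘ (ℚᵘ.mkℚᵘ z 0)) (ℤP.pos-* a b))
  (fromℚᵘ-homo-* (ℚᵘ.mkℚᵘ (+ a) 0) (ℚᵘ.mkℚᵘ (+ b) 0))

ratio-split : ∀ a d → ratio a d ≡ fromℕ a · ratio 1 d
ratio-split a zero    = sym (ℚP.*-zeroʳ (fromℕ a))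
ratio-split a (suc d) =
  trans (cong₂ (λ z e → fromℚᵘ (ℚᵘ.mkℚᵘ z e)) (sym (ℤP.*-identityʳ (+ a))) (sym (ℕP.+-identityʳ d)))
        (fromℚᵘ-homo-* (ℚᵘ.mkℚᵘ (+ a) 0) (ℚᵘ.mkℚᵘ (+ 1) d))

ratio-self : ∀ d → d ≥ 1 → ratio d d ≡ 1ℚ
ratio-self (suc d) _ =
  ℚP.fromℚᵘ-cong {ℚᵘ.mkℚᵘ (+ suc d) d} {ℚᵘ.mkℚᵘ (+ 1) 0} (ℚᵘ.*≡* (ℤP.*-comm (+ suc d) (+ 1)))

ratio-*-cancelˡ : ∀ k a d → ratio (suc k * a) (suc k * d) ≡ ratio a d
ratio-*-cancelˡ k a zero rewrite ℕP.*-zeroʳ k = refl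
ratio-*-cancelˡ k a (suc d) =
  ℚP.fromℚᵘ-cong {ℚᵘ.mkℚᵘ (+ (suc k * a)) (d ℕ.+ k * suc d)} {ℚᵘ.mkℚᵘ (+ a) d} (ℚᵘ.*≡* (begin
    + (suc k * a) ℤ.* + suc d   ≡⟨ ℤP.pos-* (suc k * a) (suc d) ⟨
    + (suc k * a * suc d)       ≡⟨ cong (λ m → + (m * suc d)) (ℕP.*-comm (suc k) a) ⟩
    + (a * suc k * suc d)       ≡⟨ cong +_ (ℕP.*-assoc a (suc k) (suc d)) ⟩
    + (a * (suc k * suc d))     ≡⟨ ℤP.pos-* a (suc k * suc d) ⟩
    + a ℤ.* + (suc k * suc d)   ∎))
  where open ≡-Reasoning

𝟙 : Bool → ℚ
𝟙 b = fromℕ (b2n b)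

𝟙-∧ : ∀ a b → 𝟙 (a ∧ b) ≡ 𝟙 a · 𝟙 b
𝟙-∧ true  true  = refl
𝟙-∧ true  false = refl
𝟙-∧ false true  = refl
𝟙-∧ false false = refl

sumFin≡∑ : ∀ n (f : Fin n → ℕ) → sumFin n f ≡ ℕΣ.sum f
sumFin≡∑ zero    f = refl
sumFin≡∑ (suc n) f = cong (f zero ℕ.+_) (sumFin≡∑ n (f ∘ suc))

sumFin-cong : ∀ n {f g : Fin n → ℕ} → f ≗ g → sumFin n f ≡ sumFin n g
sumFin-cong n {f} {g} f≗g = trans (sumFin≡∑ n f) (trans (ℕΣ.sum-cong-≗ f≗g) (sym (sumFin≡∑ n g)))

sumFinℚ≡∑ : ∀ n (f : Fin n → ℚ) → sumFinℚ n f ≡ ∑[ i < n ] f i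
sumFinℚ≡∑ zero    f = refl
sumFinℚ≡∑ (suc n) f = cong (_+_ (f zero)) (sumFinℚ≡∑ n (f ∘ suc))

fromℕ-sumFin : ∀ n (f : Fin n → ℕ) → fromℕ (sumFin n f) ≡ ∑[ i < n ] fromℕ (f i)
fromℕ-sumFin zero    f = refl
fromℕ-sumFin (suc n) f = trans (fromℕ-homo-+ (f zero) (sumFin n (f ∘ suc)))
  (cong (_+_ (fromℕ (f zero))) (fromℕ-sumFin n (f ∘ suc)))

∑-indicator : ∀ {m} (f : Fin m → ℚ) (a : Fin m) → ∑[ k < m ] (f k · 𝟙 ⌊ a ≟ k ⌋) ≡ f a
∑-indicator {suc m} f zero = begin
  f zero · 1ℚ + ∑[ k < m ] (f (suc k) · 0ℚ)  ≡⟨ cong₂ _+_ (ℚP.*-identityʳ (f zero)) (sum-cong-≗ (ℚP.*-zeroʳ ∘ f ∘ suc)) ⟩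
  f zero + ∑[ k < m ] 0ℚ                      ≡⟨ cong (_+_ (f zero)) (sum-replicate-zero m) ⟩
  f zero + 0ℚ                                 ≡⟨ ℚP.+-identityʳ (f zero) ⟩
  f zero                                      ∎
  where open ≡-Reasoning
∑-indicator {suc m} f (suc a) = begin
  f zero · 0ℚ + ∑[ k < m ] (f (suc k) · 𝟙 ⌊ suc a ≟ suc k ⌋)  ≡⟨ cong₂ _+_ (ℚP.*-zeroʳ (f zero)) (sum-cong-≗ drop-suc) ⟩
  0ℚ + ∑[ k < m ] (f (suc k) · 𝟙 ⌊ a ≟ k ⌋)                  ≡⟨ ℚP.+-identityˡ _ ⟩
  ∑[ k < m ] (f (suc k) · 𝟙 ⌊ a ≟ k ⌋)                       ≡⟨ ∑-indicator (f ∘ suc) a ⟩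
  f (suc a)                                                   ∎
  where
  open ≡-Reasoning
  drop-suc : ∀ k → f (suc k) · 𝟙 ⌊ suc a ≟ suc k ⌋ ≡ f (suc k) · 𝟙 ⌊ a ≟ k ⌋
  drop-suc k = cong (λ b → f (suc k) · 𝟙 b) (⌊⌋-map′ (cong suc) Fin.suc-injective (a ≟ k))

handshake : ∀ {n} (R : Fin n → Fin n → Bool) → (∀ i j → R i j ≡ R j i) → (∀ i → R i i ≡ false) →
  sumFin n (λ i → sumFin n (λ j → b2n (R i j))) ≡
  2 * sumFin n (λ i → sumFin n (λ j → b2n ((toℕ i <ᵇ toℕ j) ∧ R i j)))
handshake {n} R R-sym R-irrefl = begin
  sumFin n (λ i → sumFin n (λ j → b2n (R i j)))  ≡⟨ sumFin²≡∑² _ ⟩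
  ℕΣ.sum (λ i → ℕΣ.sum (λ j → b2n (R i j)))       ≡⟨ ℕΣ.sum-cong-≗ (λ i → ℕΣ.sum-cong-≗ (split-by-order i)) ⟩
  ℕΣ.sum (λ i → ℕΣ.sum (λ j → h i j ℕ.+ h j i))   ≡⟨ ℕΣ.sum-cong-≗ (λ i → ℕΣ.∑-distrib-+ (h i) (λ j → h j i)) ⟩
  ℕΣ.sum (λ i → ℕΣ.sum (h i) ℕ.+ ℕΣ.sum (λ j → h j i))  ≡⟨ ℕΣ.∑-distrib-+ (ℕΣ.sum ∘ h) _ ⟩
  E ℕ.+ ℕΣ.sum (λ i → ℕΣ.sum (λ j → h j i))       ≡⟨ cong (E ℕ.+_) (ℕΣ.∑-comm (λ i j → h j i)) ⟩
  E ℕ.+ E                                          ≡⟨ cong (E ℕ.+_) (ℕP.+-identityʳ E) ⟨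
  2 * E                                            ≡⟨ cong (2 *_) (sumFin²≡∑² _) ⟨
  2 * sumFin n (λ i → sumFin n (h i))              ∎
  where
  open ≡-Reasoning
  h : Fin n → Fin n → ℕ
  h i j = b2n ((toℕ i <ᵇ toℕ j) ∧ R i j)
  E : ℕ
  E = ℕΣ.sum (λ i → ℕΣ.sum (h i))
  sumFin²≡∑² : (f : Fin n → Fin n → ℕ) → sumFin n (λ i → sumFin n (f i)) ≡ ℕΣ.sum (λ i → ℕΣ.sum (f i))
  sumFin²≡∑² f = trans (sumFin≡∑ n _) (ℕΣ.sum-cong-≗ (λ i → sumFin≡∑ n (f i)))
  <ᵇ-true : ∀ {m n} → m ℕ.< n → (m <ᵇ n) ≡ true
  <ᵇ-true {m} {n} = dec-true (m ℕP.<? n)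
  <ᵇ-false : ∀ {m n} → ¬ m ℕ.< n → (m <ᵇ n) ≡ false
  <ᵇ-false {m} {n} = dec-false (m ℕP.<? n)
  split-by-order : ∀ i j → b2n (R i j) ≡ h i j ℕ.+ h j i
  split-by-order i j with Fin.<-cmp i j
  ... | tri< i<j _ j≮i rewrite <ᵇ-true i<j | <ᵇ-false j≮i = sym (ℕP.+-identityʳ _)
  ... | tri> i≮j _ j<i rewrite <ᵇ-false i≮j | <ᵇ-true j<i = cong b2n (R-sym i j)
  ... | tri≈ _ refl _ rewrite R-irrefl i | ∧-zeroʳ (toℕ i <ᵇ toℕ i) = refl

infixl 6 _+ᵛ_
infixr 7 _*ᵛ_
_+ᵛ_ : ∀ {n} → Vector ℚ n → Vector ℚ n → Vector ℚ n
(x +ᵛ y) i = x i + y i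

_*ᵛ_ : ∀ {n} → ℚ → Vector ℚ n → Vector ℚ n
(a *ᵛ x) i = a · x i

1ᵛ : ∀ {n} → Vector ℚ n
1ᵛ _ = 1ℚ

⟨_∣_∣_⟩ : ∀ {n} → Vector ℚ n → (Fin n → Fin n → ℚ) → Vector ℚ n → ℚ
⟨_∣_∣_⟩ {n} x A y = ∑[ i < n ] (x i · ∑[ j < n ] (A i j · y j))

module _ {n} (A : Fin n → Fin n → ℚ) where

  ⟨⟩-cong : ∀ {x x' y y'} → x ≗ x' → y ≗ y' → ⟨ x ∣ A ∣ y ⟩ ≡ ⟨ x' ∣ A ∣ y' ⟩
  ⟨⟩-cong x≗x' y≗y' =
    sum-cong-≗ (λ i → cong₂ _·_ (x≗x' i) (sum-cong-≗ (λ j → cong (A i j ·_) (y≗y' j))))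

  ⟨⟩-+ˡ : ∀ x y z → ⟨ x +ᵛ y ∣ A ∣ z ⟩ ≡ ⟨ x ∣ A ∣ z ⟩ + ⟨ y ∣ A ∣ z ⟩
  ⟨⟩-+ˡ x y z = trans (sum-cong-≗ (λ i → ℚP.*-distribʳ-+ (Az i) (x i) (y i)))
                      (∑-distrib-+ (λ i → x i · Az i) (λ i → y i · Az i))
    where
    Az : Fin n → ℚ
    Az i = ∑[ j < n ] (A i j · z j)

  ⟨⟩-*ˡ : ∀ a x z → ⟨ a *ᵛ x ∣ A ∣ z ⟩ ≡ a · ⟨ x ∣ A ∣ z ⟩
  ⟨⟩-*ˡ a x z = trans (sum-cong-≗ (λ i → ℚP.*-assoc a (x i) (Az i))) (sym (*-distribˡ-sum a (λ i → x i · Az i)))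
    where
    Az : Fin n → ℚ
    Az i = ∑[ j < n ] (A i j · z j)

  ⟨⟩-comm : (∀ i j → A i j ≡ A j i) → ∀ x y → ⟨ x ∣ A ∣ y ⟩ ≡ ⟨ y ∣ A ∣ x ⟩
  ⟨⟩-comm A-sym x y = begin
    ∑[ i < n ] (x i · ∑[ j < n ] (A i j · y j))    ≡⟨ sum-cong-≗ (λ i → *-distribˡ-sum (x i) (λ j → A i j · y j)) ⟩
    ∑[ i < n ] ∑[ j < n ] (x i · (A i j · y j))    ≡⟨ ∑-comm (λ i j → x i · (A i j · y j)) ⟩
    ∑[ j < n ] ∑[ i < n ] (x i · (A i j · y j))    ≡⟨ sum-cong-≗ (λ j → sum-cong-≗ (λ i → transpose i j)) ⟩
    ∑[ j < n ] ∑[ i < n ] (y j · (A j i · x i))    ≡⟨ sum-cong-≗ (λ j → *-distribˡ-sum (y j) (λ i → A j i · x i)) ⟨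
    ∑[ j < n ] (y j · ∑[ i < n ] (A j i · x i))    ∎
    where
    open ≡-Reasoning
    transpose : ∀ i j → x i · (A i j · y j) ≡ y j · (A j i · x i)
    transpose i j rewrite A-sym i j =
      solve 3 (λ u a v → u :* (a :* v) := v :* (a :* u)) refl (x i) (A j i) (y j)

sign : Bool → ℚ
sign true  = 1ℚ
sign false = - 1ℚ

sign-*-sign : ∀ b → sign b · sign b ≡ 1ℚ
sign-*-sign true  = refl
sign-*-sign false = refl

∃-sign-nonNeg : ∀ r → ∃[ b ] 0ℚ ≤ sign b · r
∃-sign-nonNeg r with ℚP.≤-total 0ℚ r
... | inj₁ 0≤r = true , subst (0ℚ ≤_) (sym (ℚP.*-identityˡ r)) 0≤r
... | inj₂ r≤0 = false , subst (0ℚ ≤_) -r≡-1·r (ℚP.neg-antimono-≤ r≤0)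
  where
  -r≡-1·r : - r ≡ - 1ℚ · r
  -r≡-1·r = trans (cong -_ (sym (ℚP.*-identityˡ r))) (ℚP.neg-distribˡ-* 1ℚ r)

signedSum : ∀ {m n} → (Fin m → Bool) → (Fin m → Vector ℚ n) → Vector ℚ n
signedSum {m} σ P v = ∑[ k < m ] (sign (σ k) · P k v)

module SymmetricBilinearForm {n} (β : Vector ℚ n → Vector ℚ n → ℚ)
  (β-cong : ∀ {x x' y y'} → x ≗ x' → y ≗ y' → β x y ≡ β x' y')
  (β-sym : ∀ x y → β x y ≡ β y x)
  (β-+ˡ : ∀ x y z → β (x +ᵛ y) z ≡ β x z + β y z)
  (β-*ˡ : ∀ a x z → β (a *ᵛ x) z ≡ a · β x z)
  where

  Q : Vector ℚ n → ℚ
  Q x = β x x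

  Q-cong : ∀ {x y} → x ≗ y → Q x ≡ Q y
  Q-cong x≗y = β-cong x≗y x≗y

  β-+ʳ : ∀ x y z → β x (y +ᵛ z) ≡ β x y + β x z
  β-+ʳ x y z = trans (β-sym x _) (trans (β-+ˡ y z x) (cong₂ _+_ (β-sym y x) (β-sym z x)))

  β-*ʳ : ∀ a x y → β x (a *ᵛ y) ≡ a · β x y
  β-*ʳ a x y = trans (β-sym x _) (trans (β-*ˡ a y x) (cong (a ·_) (β-sym y x)))

  Q-+ : ∀ x y → Q (x +ᵛ y) ≡ Q x + Q y + (β x y + β x y)
  Q-+ x y = begin
    β (x +ᵛ y) (x +ᵛ y)                   ≡⟨ β-+ˡ x y (x +ᵛ y) ⟩
    β x (x +ᵛ y) + β y (x +ᵛ y)           ≡⟨ cong₂ _+_ (β-+ʳ x x y) (β-+ʳ y x y) ⟩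
    (Q x + β x y) + (β y x + Q y)         ≡⟨ cong (λ t → (Q x + β x y) + (t + Q y)) (β-sym y x) ⟩
    (Q x + β x y) + (β x y + Q y)
      ≡⟨ solve 3 (λ p r s → (p :+ r) :+ (r :+ s) := p :+ s :+ (r :+ r)) refl (Q x) (β x y) (Q y) ⟩
    Q x + Q y + (β x y + β x y)           ∎
    where open ≡-Reasoning

  Q-* : ∀ a x → Q (a *ᵛ x) ≡ a · a · Q x
  Q-* a x = trans (β-*ˡ a x (a *ᵛ x)) (trans (cong (a ·_) (β-*ʳ a x x)) (sym (ℚP.*-assoc a a (Q x))))

  Q-radical : ∀ {z} → (∀ y → β z y ≡ 0ℚ) → ∀ a b x → Q (a *ᵛ x +ᵛ b *ᵛ z) ≡ a · a · Q x
  Q-radical {z} z⊥ a b x = begin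
    Q (a *ᵛ x +ᵛ b *ᵛ z)
      ≡⟨ Q-+ (a *ᵛ x) (b *ᵛ z) ⟩
    Q (a *ᵛ x) + Q (b *ᵛ z) + (β (a *ᵛ x) (b *ᵛ z) + β (a *ᵛ x) (b *ᵛ z))
      ≡⟨ cong₂ (λ s t → Q (a *ᵛ x) + s + (t + t)) (bz⊥ (b *ᵛ z)) (trans (β-sym (a *ᵛ x) (b *ᵛ z)) (bz⊥ (a *ᵛ x))) ⟩
    Q (a *ᵛ x) + 0ℚ + (0ℚ + 0ℚ)
      ≡⟨ trans (ℚP.+-identityʳ (Q (a *ᵛ x) + 0ℚ)) (ℚP.+-identityʳ (Q (a *ᵛ x))) ⟩
    Q (a *ᵛ x)
      ≡⟨ Q-* a x ⟩
    a · a · Q x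
      ∎
    where
    open ≡-Reasoning
    bz⊥ : ∀ y → β (b *ᵛ z) y ≡ 0ℚ
    bz⊥ y = trans (β-*ˡ b z y) (trans (cong (b ·_) (z⊥ y)) (ℚP.*-zeroʳ b))

  Q-signed-+ : ∀ s x y → Q (sign s *ᵛ x +ᵛ y) ≡ Q x + Q y + (sign s · β x y + sign s · β x y)
  Q-signed-+ s x y = begin
    Q (sign s *ᵛ x +ᵛ y)
      ≡⟨ Q-+ (sign s *ᵛ x) y ⟩
    Q (sign s *ᵛ x) + Q y + (β (sign s *ᵛ x) y + β (sign s *ᵛ x) y)
      ≡⟨ cong₂ (λ p u → p + Q y + (u + u)) (Q-* (sign s) x) (β-*ˡ (sign s) x y) ⟩
    sign s · sign s · Q x + Q y + (t + t)
      ≡⟨ cong (λ e → e · Q x + Q y + (t + t)) (sign-*-sign s) ⟩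
    1ℚ · Q x + Q y + (t + t)
      ≡⟨ cong (λ p → p + Q y + (t + t)) (ℚP.*-identityˡ (Q x)) ⟩
    Q x + Q y + (t + t)
      ∎
    where
    open ≡-Reasoning
    t : ℚ
    t = sign s · β x y

  ∑Q≤Q-signedSum : ∀ {m} (P : Fin m → Vector ℚ n) → ∃[ σ ] ∑[ k < m ] Q (P k) ≤ Q (signedSum σ P)
  ∑Q≤Q-signedSum {zero} P =
    (λ ()) , ℚP.≤-reflexive (sym (trans (Q-* 0ℚ (λ _ → 0ℚ)) (ℚP.*-zeroˡ (Q (λ _ → 0ℚ)))))
  ∑Q≤Q-signedSum {suc m} P with ∑Q≤Q-signedSum (P ∘ suc)
  ... | σ , IH with ∃-sign-nonNeg (β (P zero) (signedSum σ (P ∘ suc)))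
  ... | s , 0≤sr = s ∷ σ , (begin
    Q (P zero) + ∑[ k < m ] Q (P (suc k))           ≡⟨ ℚP.+-identityʳ _ ⟨
    Q (P zero) + ∑[ k < m ] Q (P (suc k)) + 0ℚ      ≤⟨ ℚP.+-mono-≤ (ℚP.+-monoʳ-≤ (Q (P zero)) IH) (ℚP.+-mono-≤ 0≤sr 0≤sr) ⟩
    Q (P zero) + Q s′ + (sign s · r + sign s · r)   ≡⟨ Q-signed-+ s (P zero) s′ ⟨
    Q (sign s *ᵛ P zero +ᵛ s′)                      ∎)
    where
    open ℚP.≤-Reasoning
    s′ : Vector ℚ n
    s′ = signedSum σ (P ∘ suc)
    r : ℚ
    r = β (P zero) s′

module ModularityForm {n} (A : Fin n → Fin n → ℚ) (A-sym : ∀ i j → A i j ≡ A j i) (c : ℚ) where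

  -- β x y = xᵀ (c A − c² d dᵀ) y with d = A 1ᵛ; for c = 1 / vol(G) this is the modularity matrix.
  β : Vector ℚ n → Vector ℚ n → ℚ
  β x y = ⟨ x ∣ A ∣ y ⟩ · c - (⟨ x ∣ A ∣ 1ᵛ ⟩ · c) · (⟨ y ∣ A ∣ 1ᵛ ⟩ · c)

  β-cong : ∀ {x x' y y'} → x ≗ x' → y ≗ y' → β x y ≡ β x' y'
  β-cong x≗x' y≗y' = cong₂ _-_ (cong (_· c) (⟨⟩-cong A x≗x' y≗y'))
    (cong₂ (λ u v → (u · c) · (v · c)) (⟨⟩-cong A x≗x' λ _ → refl) (⟨⟩-cong A y≗y' λ _ → refl))

  β-sym : ∀ x y → β x y ≡ β y x
  β-sym x y =
    cong₂ _-_ (cong (_· c) (⟨⟩-comm A A-sym x y)) (ℚP.*-comm (⟨ x ∣ A ∣ 1ᵛ ⟩ · c) (⟨ y ∣ A ∣ 1ᵛ ⟩ · c))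

  β-+ˡ : ∀ x y z → β (x +ᵛ y) z ≡ β x z + β y z
  β-+ˡ x y z = begin
    ⟨ x +ᵛ y ∣ A ∣ z ⟩ · c - (⟨ x +ᵛ y ∣ A ∣ 1ᵛ ⟩ · c) · (⟨ z ∣ A ∣ 1ᵛ ⟩ · c)
      ≡⟨ cong₂ (λ u v → u · c - (v · c) · (⟨ z ∣ A ∣ 1ᵛ ⟩ · c)) (⟨⟩-+ˡ A x y z) (⟨⟩-+ˡ A x y 1ᵛ) ⟩
    (⟨ x ∣ A ∣ z ⟩ + ⟨ y ∣ A ∣ z ⟩) · c - ((⟨ x ∣ A ∣ 1ᵛ ⟩ + ⟨ y ∣ A ∣ 1ᵛ ⟩) · c) · (⟨ z ∣ A ∣ 1ᵛ ⟩ · c)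
      ≡⟨ solve 6 (λ xz yz x1 y1 z1 c → (xz :+ yz) :* c :- ((x1 :+ y1) :* c) :* (z1 :* c)
                                         := (xz :* c :- (x1 :* c) :* (z1 :* c)) :+ (yz :* c :- (y1 :* c) :* (z1 :* c)))
                 refl ⟨ x ∣ A ∣ z ⟩ ⟨ y ∣ A ∣ z ⟩ ⟨ x ∣ A ∣ 1ᵛ ⟩ ⟨ y ∣ A ∣ 1ᵛ ⟩ ⟨ z ∣ A ∣ 1ᵛ ⟩ c ⟩
    β x z + β y z
      ∎
    where open ≡-Reasoning

  β-*ˡ : ∀ a x z → β (a *ᵛ x) z ≡ a · β x z
  β-*ˡ a x z = begin
    ⟨ a *ᵛ x ∣ A ∣ z ⟩ · c - (⟨ a *ᵛ x ∣ A ∣ 1ᵛ ⟩ · c) · (⟨ z ∣ A ∣ 1ᵛ ⟩ · c)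
      ≡⟨ cong₂ (λ u v → u · c - (v · c) · (⟨ z ∣ A ∣ 1ᵛ ⟩ · c)) (⟨⟩-*ˡ A a x z) (⟨⟩-*ˡ A a x 1ᵛ) ⟩
    (a · ⟨ x ∣ A ∣ z ⟩) · c - ((a · ⟨ x ∣ A ∣ 1ᵛ ⟩) · c) · (⟨ z ∣ A ∣ 1ᵛ ⟩ · c)
      ≡⟨ solve 5 (λ a xz x1 z1 c → (a :* xz) :* c :- ((a :* x1) :* c) :* (z1 :* c)
                                    := a :* (xz :* c :- (x1 :* c) :* (z1 :* c)))
                 refl a ⟨ x ∣ A ∣ z ⟩ ⟨ x ∣ A ∣ 1ᵛ ⟩ ⟨ z ∣ A ∣ 1ᵛ ⟩ c ⟩
    a · β x z
      ∎
    where open ≡-Reasoning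

  β-1ᵛ : ⟨ 1ᵛ ∣ A ∣ 1ᵛ ⟩ · c ≡ 1ℚ → ∀ y → β 1ᵛ y ≡ 0ℚ
  β-1ᵛ total y = begin
    ⟨ 1ᵛ ∣ A ∣ y ⟩ · c - (⟨ 1ᵛ ∣ A ∣ 1ᵛ ⟩ · c) · (⟨ y ∣ A ∣ 1ᵛ ⟩ · c)
      ≡⟨ cong₂ (λ u v → u · c - v · (⟨ y ∣ A ∣ 1ᵛ ⟩ · c)) (⟨⟩-comm A A-sym 1ᵛ y) total ⟩
    ⟨ y ∣ A ∣ 1ᵛ ⟩ · c - 1ℚ · (⟨ y ∣ A ∣ 1ᵛ ⟩ · c)
      ≡⟨ cong (_-_ (⟨ y ∣ A ∣ 1ᵛ ⟩ · c)) (ℚP.*-identityˡ (⟨ y ∣ A ∣ 1ᵛ ⟩ · c)) ⟩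
    ⟨ y ∣ A ∣ 1ᵛ ⟩ · c - ⟨ y ∣ A ∣ 1ᵛ ⟩ · c
      ≡⟨ ℚP.+-inverseʳ (⟨ y ∣ A ∣ 1ᵛ ⟩ · c) ⟩
    0ℚ
      ∎
    where open ≡-Reasoning

χ : ∀ {n} → VSet n → Vector ℚ n
χ S v = 𝟙 (S v)

sign≗2χ-1 : ∀ {n} (S : VSet n) → sign ∘ S ≗ (1ℚ + 1ℚ) *ᵛ χ S +ᵛ (- 1ℚ) *ᵛ 1ᵛ
sign≗2χ-1 S v with S v
... | true  = refl
... | false = refl

χ-complement : ∀ {n} (S : VSet n) → χ (not ∘ S) ≗ (- 1ℚ) *ᵛ χ S +ᵛ 1ℚ *ᵛ 1ᵛ
χ-complement S v with S v
... | true  = refl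
... | false = refl

signedSum-partition : ∀ {n} (c : Partition n) (σ : Fin n → Bool) →
  signedSum σ (χ ∘ part c) ≗ sign ∘ σ ∘ c
signedSum-partition c σ v = ∑-indicator (sign ∘ σ) (c v)

module _ {n} (G : Graph n) where

  adjacency : Fin n → Fin n → ℚ
  adjacency i j = 𝟙 (adj G i j)

  adjacency-sym : ∀ i j → adjacency i j ≡ adjacency j i
  adjacency-sym i j = cong 𝟙 (adj-sym G i j)

  eS-handshake : ∀ S → sumFin n (λ i → sumFin n (λ j → b2n (adj G i j ∧ S i ∧ S j))) ≡ 2 * eS G S
  eS-handshake S = handshake (λ i j → adj G i j ∧ S i ∧ S j)
    (λ i j → cong₂ _∧_ (adj-sym G i j) (∧-comm (S i) (S j)))
    (λ i → cong (_∧ (S i ∧ S i)) (adj-irref G i))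

  volG≡2*eG : volG G ≡ 2 * eG G
  volG≡2*eG = trans (sumFin-cong n deg≡) (eS-handshake full)
    where
    deg≡ : ∀ i → b2n true * deg G i ≡ sumFin n (λ j → b2n (adj G i j ∧ true))
    deg≡ i = trans (ℕP.*-identityˡ (deg G i))
                   (sumFin-cong n (λ j → cong b2n (sym (∧-identityʳ (adj G i j)))))

  fromℕ-2*eS : ∀ S → fromℕ (2 * eS G S) ≡ ⟨ χ S ∣ adjacency ∣ χ S ⟩
  fromℕ-2*eS S = begin
    fromℕ (2 * eS G S)                                        ≡⟨ cong fromℕ (eS-handshake S) ⟨
    fromℕ (sumFin n (λ i → sumFin n (λ j → b2n (e i j))))    ≡⟨ fromℕ-sumFin n (λ i → sumFin n (λ j → b2n (e i j))) ⟩
    ∑[ i < n ] fromℕ (sumFin n (λ j → b2n (e i j)))          ≡⟨ sum-cong-≗ (λ i → fromℕ-sumFin n (λ j → b2n (e i j))) ⟩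
    ∑[ i < n ] ∑[ j < n ] 𝟙 (e i j)                          ≡⟨ sum-cong-≗ (λ i → sum-cong-≗ (𝟙-factor i)) ⟩
    ∑[ i < n ] ∑[ j < n ] (χ S i · (adjacency i j · χ S j))
      ≡⟨ sum-cong-≗ (λ i → *-distribˡ-sum (χ S i) (λ j → adjacency i j · χ S j)) ⟨
    ⟨ χ S ∣ adjacency ∣ χ S ⟩                                 ∎
    where
    open ≡-Reasoning
    e : Fin n → Fin n → Bool
    e i j = adj G i j ∧ S i ∧ S j
    𝟙-factor : ∀ i j → 𝟙 (e i j) ≡ χ S i · (adjacency i j · χ S j)
    𝟙-factor i j = begin
      𝟙 (adj G i j ∧ S i ∧ S j)               ≡⟨ 𝟙-∧ (adj G i j) (S i ∧ S j) ⟩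
      adjacency i j · 𝟙 (S i ∧ S j)           ≡⟨ cong (adjacency i j ·_) (𝟙-∧ (S i) (S j)) ⟩
      adjacency i j · (χ S i · χ S j)
        ≡⟨ solve 3 (λ a s t → a :* (s :* t) := s :* (a :* t)) refl (adjacency i j) (χ S i) (χ S j) ⟩
      χ S i · (adjacency i j · χ S j)         ∎

  fromℕ-vol : ∀ S → fromℕ (vol G S) ≡ ⟨ χ S ∣ adjacency ∣ 1ᵛ ⟩
  fromℕ-vol S = trans (fromℕ-sumFin n (λ i → b2n (S i) * deg G i))
    (sum-cong-≗ (λ i → trans (fromℕ-homo-* (b2n (S i)) (deg G i)) (cong (χ S i ·_) (fromℕ-deg i))))
    where
    fromℕ-deg : ∀ i → fromℕ (deg G i) ≡ ∑[ j < n ] (adjacency i j · 1ℚ)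
    fromℕ-deg i = trans (fromℕ-sumFin n (λ j → b2n (adj G i j)))
                        (sum-cong-≗ (λ j → sym (ℚP.*-identityʳ (adjacency i j))))

  open ModularityForm adjacency adjacency-sym (ratio 1 (volG G))
  open SymmetricBilinearForm β β-cong β-sym β-+ˡ β-*ˡ

  q≡Q : ∀ S → q G S ≡ Q (χ S)
  q≡Q S = cong₂ (λ e v → e - v · v) edge-fraction volume-fraction
    where
    open ≡-Reasoning
    c : ℚ
    c = ratio 1 (volG G)
    edge-fraction : ratio (eS G S) (eG G) ≡ ⟨ χ S ∣ adjacency ∣ χ S ⟩ · c
    edge-fraction = begin
      ratio (eS G S) (eG G)           ≡⟨ ratio-*-cancelˡ 1 (eS G S) (eG G) ⟨
      ratio (2 * eS G S) (2 * eG G)   ≡⟨ cong (ratio (2 * eS G S)) volG≡2*eG ⟨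
      ratio (2 * eS G S) (volG G)     ≡⟨ ratio-split (2 * eS G S) (volG G) ⟩
      fromℕ (2 * eS G S) · c          ≡⟨ cong (_· c) (fromℕ-2*eS S) ⟩
      ⟨ χ S ∣ adjacency ∣ χ S ⟩ · c   ∎
    volume-fraction : ratio (vol G S) (volG G) ≡ ⟨ χ S ∣ adjacency ∣ 1ᵛ ⟩ · c
    volume-fraction = trans (ratio-split (vol G S) (volG G)) (cong (_· c) (fromℕ-vol S))

  1ᵛ-radical : eG G ≥ 1 → ∀ y → β 1ᵛ y ≡ 0ℚ
  1ᵛ-radical eG≥1 = β-1ᵛ (begin
    ⟨ 1ᵛ ∣ adjacency ∣ 1ᵛ ⟩ · ratio 1 (volG G)   ≡⟨ cong (_· ratio 1 (volG G)) (fromℕ-vol full) ⟨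
    fromℕ (volG G) · ratio 1 (volG G)            ≡⟨ ratio-split (volG G) (volG G) ⟨
    ratio (volG G) (volG G)                       ≡⟨ ratio-self (volG G) volG≥1 ⟩
    1ℚ                                            ∎)
    where
    open ≡-Reasoning
    volG≥1 : volG G ≥ 1
    volG≥1 = subst (_≥ 1) (sym volG≡2*eG) (ℕP.≤-trans eG≥1 (ℕP.m≤m+n (eG G) (eG G ℕ.+ 0)))

  q-complement : eG G ≥ 1 → ∀ S → q G (not ∘ S) ≡ q G S
  q-complement eG≥1 S = begin
    q G (not ∘ S)                               ≡⟨ q≡Q (not ∘ S) ⟩
    Q (χ (not ∘ S))                             ≡⟨ Q-cong (χ-complement S) ⟩
    Q ((- 1ℚ) *ᵛ χ S +ᵛ 1ℚ *ᵛ 1ᵛ)              ≡⟨ Q-radical (1ᵛ-radical eG≥1) (- 1ℚ) 1ℚ (χ S) ⟩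
    (- 1ℚ) · (- 1ℚ) · Q (χ S)                  ≡⟨ ℚP.*-identityˡ (Q (χ S)) ⟩
    Q (χ S)                                     ≡⟨ q≡Q S ⟨
    q G S                                       ∎
    where open ≡-Reasoning

  Q-sign : eG G ≥ 1 → ∀ S → Q (sign ∘ S) ≡ (1ℚ + 1ℚ + 1ℚ + 1ℚ) · q G S
  Q-sign eG≥1 S = begin
    Q (sign ∘ S)                                ≡⟨ Q-cong (sign≗2χ-1 S) ⟩
    Q ((1ℚ + 1ℚ) *ᵛ χ S +ᵛ (- 1ℚ) *ᵛ 1ᵛ)        ≡⟨ Q-radical (1ᵛ-radical eG≥1) (1ℚ + 1ℚ) (- 1ℚ) (χ S) ⟩
    (1ℚ + 1ℚ) · (1ℚ + 1ℚ) · Q (χ S)            ≡⟨ cong (_· Q (χ S)) 2·2≡4 ⟩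
    (1ℚ + 1ℚ + 1ℚ + 1ℚ) · Q (χ S)              ≡⟨ cong ((1ℚ + 1ℚ + 1ℚ + 1ℚ) ·_) (q≡Q S) ⟨
    (1ℚ + 1ℚ + 1ℚ + 1ℚ) · q G S                ∎
    where
    open ≡-Reasoning
    2·2≡4 : (1ℚ + 1ℚ) · (1ℚ + 1ℚ) ≡ 1ℚ + 1ℚ + 1ℚ + 1ℚ
    2·2≡4 = refl

  modP≡∑Q : ∀ c → modP G c ≡ ∑[ k < n ] Q (χ (part c k))
  modP≡∑Q c = trans (sumFinℚ≡∑ n (λ k → q G (part c k))) (sum-cong-≗ (q≡Q ∘ part c))

  modularity-bound : eG G ≥ 1 → ∀ c → Σ (VSet n) λ S → modP G c ≤ (1ℚ + 1ℚ + 1ℚ + 1ℚ) · q G S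
  modularity-bound eG≥1 c = σ ∘ c , (begin
    modP G c                                    ≡⟨ modP≡∑Q c ⟩
    ∑[ k < n ] Q (χ (part c k))                 ≤⟨ proj₂ (∑Q≤Q-signedSum (χ ∘ part c)) ⟩
    Q (signedSum σ (χ ∘ part c))                ≡⟨ Q-cong (signedSum-partition c σ) ⟩
    Q (sign ∘ σ ∘ c)                            ≡⟨ Q-sign eG≥1 (σ ∘ c) ⟩
    (1ℚ + 1ℚ + 1ℚ + 1ℚ) · q G (σ ∘ c)          ∎)
    where
    open ℚP.≤-Reasoning
    σ : Fin n → Bool
    σ = proj₁ (∑Q≤Q-signedSum (χ ∘ part c))

card-complement : ∀ {n} (S : VSet n) → card S ℕ.+ card (not ∘ S) ≡ n
card-complement {zero}  S = refl
card-complement {suc n} S with S zero | card-complement (S ∘ suc)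
... | true  | IH = cong suc IH
... | false | IH = trans (ℕP.+-suc _ _) (cong suc IH)

m+n≤2*m : ∀ {m n} → n ℕ.≤ m → m ℕ.+ n ℕ.≤ 2 * m
m+n≤2*m {m} n≤m = ℕP.+-monoʳ-≤ m (ℕP.≤-trans n≤m (ℕP.m≤m+n m 0))

card-half : ∀ {n} (S : VSet n) → 2 * card S ≥ n ⊎ 2 * card (not ∘ S) ≥ n
card-half S with ℕP.≤-total (card (not ∘ S)) (card S)
... | inj₁ Sᶜ≤S = inj₁ (subst (ℕ._≤ 2 * card S) (card-complement S) (m+n≤2*m Sᶜ≤S))
... | inj₂ S≤Sᶜ = inj₂ (subst (ℕ._≤ 2 * card (not ∘ S))
                             (trans (ℕP.+-comm (card (not ∘ S)) (card S)) (card-complement S))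
                             (m+n≤2*m S≤Sᶜ))

large-side : ∀ {n} (P : VSet n → Set) (S : VSet n) → P S → P (not ∘ S) →
  Σ (VSet n) λ T → 2 * card T ≥ n × P T
large-side P S PS PSᶜ with card-half S
... | inj₁ S-large  = S , S-large , PS
... | inj₂ Sᶜ-large = not ∘ S , Sᶜ-large , PSᶜ

corollary3 : (n : ℕ) (G : Graph n) → eG G ≥ 1 →
    (c : Partition n) →
      Σ (VSet n) (λ S → (2 * card S ≥ n) ×
        (modP G c ≤ ((1ℚ + 1ℚ + 1ℚ + 1ℚ) *ℚ q G S)))
corollary3 n G eG≥1 c = large-side (λ S → modP G c ≤ (1ℚ + 1ℚ + 1ℚ + 1ℚ) *ℚ q G S) S bound
  (subst (λ t → modP G c ≤ (1ℚ + 1ℚ + 1ℚ + 1ℚ) *ℚ t) (sym (q-complement G eG≥1 S)) bound)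
  where
  S : VSet n
  S = proj₁ (modularity-bound G eG≥1 c)
  bound : modP G c ≤ (1ℚ + 1ℚ + 1ℚ + 1ℚ) *ℚ q G S
  bound = proj₂ (modularity-bound G eG≥1 c)
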